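{- Let $p$ be a prime, $l\in\mathbb{N}$, $x\in\mathbb{R}$, and let $\{p_i/q_i\}_{i\ge0}$ be the sequence of convergents of an $\mathcal{F}_{p^l}$-continued fraction expansion of $x$. Let $u/v\in\mathcal{X}_{p^l}\setminus\{\infty\}$ (lowest terms, $v>0$) and let $n\ge0$ be such that $p_{n+1}/q_{n+1}$ is defined. Then there exists a unique pair $(\alpha,\beta)\in\mathbb{Z}\times\mathbb{Z}$ such that $\begin{pmatrix}u\\ v\end{pmatrix}=\alpha\begin{pmatrix}p_{n+1}\\ q_{n+1}\end{pmatrix}+\beta\begin{pmatrix}p_n\\ q_n\end{pmatrix}$.
   Context: $\mathcal{X}_{p^l}=\{x/y: x,y\in\mathbb{Z},\ y>0,\ \gcd(x,y)=1,\ p^l\mid y\}\cup\{\infty\}$. An $\mathcal{F}_{p^l}$-continued fraction is a finite expression $\frac{1}{0+}\,\frac{p^l}{b+}\,\frac{\epsilon_1}{a_1+}\cdots\frac{\epsilon_n}{a_n}$ ($n\ge0$) or an infinite expression $\frac{1}{0+}\,\frac{p^l}{b+}\,\frac{\epsilon_1}{a_1+}\,\frac{\epsilon_2}{a_2+}\cdots$, where $b\in\mathbb{Z}$ is coprime to $p$, $a_i\in\mathbb{N}$, $\epsilon_i\in\{1,-1\}$, and for all relevant $i\ge1$: $a_i+\epsilon_{i+1}\ge1$, $a_i+\epsilon_i\ge1$, $\gcd(p_i,q_i)=1$ where $p_i=a_ip_{i-1}+\epsilon_ip_{i-2}$, $q_i=a_iq_{i-1}+\epsilon_iq_{i-2}$,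 $(p_{ -1},q_{ -1})=(1,0)$, $(p_0,q_0)=(b,p^l)$. The $p_i/q_i$ ($i\ge0$) are its convergents; its value is the last convergent or the limit of convergents, and an expansion of $x$ is one with value $x$. -}

module Defs where

open import Data.Nat as ℕ using (ℕ; zero; suc; _^_)
open import Data.Nat.Coprimality using (Coprime)
open import Data.Integer as ℤ using (ℤ; +_; ∣_∣)
open import Data.Product using (_×_)
open import Data.Sum using (_⊎_)
open import Data.Unit using (⊤)
open import Relation.Binary.PropositionalEquality using (_≡_)

-- Length of an F_{p^l}-continued fraction: finitely many terms
-- (a_1..a_n, n ≥ 0) or infinitely many.
data Len : Set where
  fin : ℕ → Len
  inf : Len

-- index i (≥ 1) is "relevant", i.e. the term a_i / ε_i exists
Relevant : Len → ℕ → Set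
Relevant (fin n) i = i ℕ.≤ n
Relevant inf     i = ⊤

-- Shifted recurrence: P′ k = p_{k-1}, Q′ k = q_{k-1}
-- with (p_{-1},q_{-1}) = (1,0), (p_0,q_0) = (b, p^l),
-- p_i = a_i p_{i-1} + ε_i p_{i-2}.
P′ : ℤ → (ℕ → ℕ) → (ℕ → ℤ) → ℕ → ℤ
P′ b a ε zero = + 1
P′ b a ε (suc zero) = b
P′ b a ε (suc (suc k)) =
  (+ a (suc k)) ℤ.* P′ b a ε (suc k) ℤ.+ ε (suc k) ℤ.* P′ b a ε k

Q′ : ℕ → (ℕ → ℕ) → (ℕ → ℤ) → ℕ → ℤ
Q′ pl a ε zero = + 0
Q′ pl a ε (suc zero) = + pl
Q′ pl a ε (suc (suc k)) =
  (+ a (suc k)) ℤ.* Q′ pl a ε (suc k) ℤ.+ ε (suc k) ℤ.* Q′ pl a ε k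

conv-p : ℤ → (ℕ → ℕ) → (ℕ → ℤ) → ℕ → ℤ
conv-p b a ε i = P′ b a ε (suc i)

conv-q : ℕ → ℕ → (ℕ → ℕ) → (ℕ → ℤ) → ℕ → ℤ
conv-q p l a ε i = Q′ (p ^ l) a ε (suc i)

-- The side conditions of an F_{p^l}-continued fraction
--   1/(0+) p^l/(b+) ε_1/(a_1+) ε_2/(a_2+) ...
-- with terms indexed 1.. (values of a, ε at index 0 / beyond the length are ignored).
record IsFCF (p l : ℕ) (b : ℤ) (a : ℕ → ℕ) (ε : ℕ → ℤ) (L : Len) : Set where
  field
    b-coprime : Coprime ∣ b ∣ p
    a-pos     : ∀ i → 1 ℕ.≤ i → Relevant L i → 1 ℕ.≤ a i
    ε-sign    : ∀ i → 1 ℕ.≤ i → Relevant L i → (ε i ≡ + 1) ⊎ (ε i ≡ ℤ.- (+ 1))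
    cond-next : ∀ i → 1 ℕ.≤ i → Relevant L (suc i) → + 1 ℤ.≤ (+ a i) ℤ.+ ε (suc i)
    cond-same : ∀ i → 1 ℕ.≤ i → Relevant L i → + 1 ℤ.≤ (+ a i) ℤ.+ ε i
    cond-gcd  : ∀ i → 1 ℕ.≤ i → Relevant L i →
                Coprime ∣ conv-p b a ε i ∣ ∣ conv-q p l a ε i ∣

-- The denominators q_i are p^l r_i, where r_i satisfy the same recurrence started from
-- (r_{-1}, r_0) = (0, 1), and the matrix [[p_{n+1}, p_n], [r_{n+1}, r_n]] is the product of
-- [[b, 1], [1, 0]] with the matrices [[a_i, 1], [ε_i, 0]], so its determinant is ±1.
-- Writing v = p^l w, the system for (u, v) is the system for (u, w) with its second row
-- scaled by p^l ≠ 0, and Cramer's rule solves the latter uniquely over ℤ.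
module Submission where

open import Defs
open import Data.Nat as ℕ using (ℕ; zero; suc; _^_)
open import Data.Nat.Primality using (Prime; prime⇒nonZero)
open import Data.Nat.Coprimality using (Coprime)
open import Data.Nat.Divisibility using (_∣_; divides)
import Data.Nat.Properties as ℕ
open import Data.Integer as ℤ using (ℤ; +_; ∣_∣; _+_; _-_; _*_; -_)
import Data.Integer.Properties as ℤ
open import Data.Integer.Tactic.RingSolver using (solve-∀)
open import Data.Product using (_×_; Σ; _,_; proj₁; proj₂)
open import Data.Sum using (_⊎_; inj₁; inj₂)
open import Relation.Binary.PropositionalEquality
  using (_≡_; refl; sym; trans; cong; module ≡-Reasoning)
open ≡-Reasoning

module Cramer {A B c e d : ℤ} (det : A * e - B * c ≡ d) (d*d≡1 : d * d ≡ + 1) where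

  coeff₁ coeff₂ : ℤ → ℤ → ℤ
  coeff₁ x y = d * (x * e - y * B)
  coeff₂ x y = d * (y * A - x * c)

  private
    unit-cancel : ∀ z → d * (z * (A * e - B * c)) ≡ z
    unit-cancel z = begin
      d * (z * (A * e - B * c)) ≡⟨ cong (λ t → d * (z * t)) det ⟩
      d * (z * d)               ≡⟨ reassoc d z ⟩
      z * (d * d)               ≡⟨ cong (z *_) d*d≡1 ⟩
      z * + 1                   ≡⟨ ℤ.*-identityʳ z ⟩
      z                         ∎
      where
      reassoc : ∀ d z → d * (z * d) ≡ z * (d * d)
      reassoc = solve-∀

  solves : ∀ x y → (x ≡ coeff₁ x y * A + coeff₂ x y * B) × (y ≡ coeff₁ x y * c + coeff₂ x y * e)
  solves x y = sym (trans (first d x y A B c e) (unit-cancel x))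
             , sym (trans (second d x y A B c e) (unit-cancel y))
    where
    first : ∀ d x y A B c e → d * (x * e - y * B) * A + d * (y * A - x * c) * B ≡ d * (x * (A * e - B * c))
    first = solve-∀
    second : ∀ d x y A B c e → d * (x * e - y * B) * c + d * (y * A - x * c) * e ≡ d * (y * (A * e - B * c))
    second = solve-∀

  unique : ∀ {x y} α β → x ≡ α * A + β * B → y ≡ α * c + β * e →
           (α ≡ coeff₁ x y) × (β ≡ coeff₂ x y)
  unique α β refl refl = sym (trans (first d α β A B c e) (unit-cancel α))
                       , sym (trans (second d α β A B c e) (unit-cancel β))
    where
    first : ∀ d α β A B c e → d * ((α * A + β * B) * e - (α * c + β * e) * B) ≡ d * (α * (A * e - B * c))
    first = solve-∀
    second : ∀ d α β A B c e → d * ((α * c + β * e) * A - (α * A + β * B) * c) ≡ d * (β * (A * e - B * c))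
    second = solve-∀

Q′-scale : ∀ m a ε k → Q′ m a ε k ≡ + m * Q′ 1 a ε k
Q′-scale m a ε zero = sym (ℤ.*-zeroʳ (+ m))
Q′-scale m a ε (suc zero) = sym (ℤ.*-identityʳ (+ m))
Q′-scale m a ε (suc (suc k))
  rewrite Q′-scale m a ε (suc k) | Q′-scale m a ε k =
    distrib (+ m) (+ a (suc k)) (ε (suc k)) (Q′ 1 a ε (suc k)) (Q′ 1 a ε k)
  where
  distrib : ∀ m x y r s → x * (m * r) + y * (m * s) ≡ m * (x * r + y * s)
  distrib = solve-∀

detSign : (ℕ → ℤ) → ℕ → ℤ
detSign ε zero = - + 1
detSign ε (suc k) = - ε (suc k) * detSign ε k

P′-Q′₁-det : ∀ b a ε k → P′ b a ε (suc k) * Q′ 1 a ε k - P′ b a ε k * Q′ 1 a ε (suc k) ≡ detSign ε k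
P′-Q′₁-det b a ε zero = base b
  where
  base : ∀ b → b * + 0 - + 1 * + 1 ≡ - + 1
  base = solve-∀
P′-Q′₁-det b a ε (suc k) = begin
  (x * P₁ + y * P₀) * R₁ - P₁ * (x * R₁ + y * R₀) ≡⟨ step x y P₁ P₀ R₁ R₀ ⟩
  - y * (P₁ * R₀ - P₀ * R₁)                       ≡⟨ cong (- y *_) (P′-Q′₁-det b a ε k) ⟩
  - y * detSign ε k                               ∎
  where
  x = + a (suc k)
  y = ε (suc k)
  P₁ = P′ b a ε (suc k)
  P₀ = P′ b a ε k
  R₁ = Q′ 1 a ε (suc k)
  R₀ = Q′ 1 a ε k
  step : ∀ x y P₁ P₀ R₁ R₀ → (x * P₁ + y * P₀) * R₁ - P₁ * (x * R₁ + y * R₀) ≡ - y * (P₁ * R₀ - P₀ * R₁)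
  step = solve-∀

detSign-square : ∀ ε k → (∀ i → 1 ℕ.≤ i → i ℕ.≤ k → (ε i ≡ + 1) ⊎ (ε i ≡ - + 1)) →
                 detSign ε k * detSign ε k ≡ + 1
detSign-square ε zero signs = refl
detSign-square ε (suc k) signs = begin
  - y * s * (- y * s)  ≡⟨ split y s ⟩
  y * y * (s * s)      ≡⟨ cong (_* (s * s)) (sign-square (signs (suc k) (ℕ.s≤s ℕ.z≤n) ℕ.≤-refl)) ⟩
  + 1 * (s * s)        ≡⟨ cong (+ 1 *_) (detSign-square ε k λ i 1≤i i≤k → signs i 1≤i (ℕ.m≤n⇒m≤1+n i≤k)) ⟩
  + 1                  ∎
  where
  y = ε (suc k)
  s = detSign ε k
  split : ∀ y s → - y * s * (- y * s) ≡ y * y * (s * s)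
  split = solve-∀
  sign-square : ∀ {y} → (y ≡ + 1) ⊎ (y ≡ - + 1) → y * y ≡ + 1
  sign-square (inj₁ refl) = refl
  sign-square (inj₂ refl) = refl

Relevant-≤ : ∀ L {i j} → i ℕ.≤ j → Relevant L j → Relevant L i
Relevant-≤ (fin m) i≤j j≤m = ℕ.≤-trans i≤j j≤m
Relevant-≤ inf     i≤j _   = _

conv-q-combination : ∀ p l a ε n α β →
  α * conv-q p l a ε (suc n) + β * conv-q p l a ε n ≡
  + (p ^ l) * (α * Q′ 1 a ε (suc (suc n)) + β * Q′ 1 a ε (suc n))
conv-q-combination p l a ε n α β
  rewrite Q′-scale (p ^ l) a ε (suc (suc n)) | Q′-scale (p ^ l) a ε (suc n) =
    factor (+ (p ^ l)) α β (Q′ 1 a ε (suc (suc n))) (Q′ 1 a ε (suc n))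
  where
  factor : ∀ m α β r s → α * (m * r) + β * (m * s) ≡ m * (α * r + β * s)
  factor = solve-∀

mainTheorem7 : (p l : ℕ) → Prime p →
    (b : ℤ) (a : ℕ → ℕ) (ε : ℕ → ℤ) (L : Len) → IsFCF p l b a ε L →
    (u : ℤ) (v : ℕ) → 0 ℕ.< v → Coprime ∣ u ∣ v → p ^ l ∣ v →
    (n : ℕ) → Relevant L (suc n) →
    Σ (ℤ × ℤ) λ { (α , β) →
      ((u ≡ α ℤ.* conv-p b a ε (suc n) ℤ.+ β ℤ.* conv-p b a ε n)
        × (+ v ≡ α ℤ.* conv-q p l a ε (suc n) ℤ.+ β ℤ.* conv-q p l a ε n))
      × ((α′ β′ : ℤ) →
          (u ≡ α′ ℤ.* conv-p b a ε (suc n) ℤ.+ β′ ℤ.* conv-p b a ε n) →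
          (+ v ≡ α′ ℤ.* conv-q p l a ε (suc n) ℤ.+ β′ ℤ.* conv-q p l a ε n) →
          (α′ ≡ α) × (β′ ≡ β)) }
mainTheorem7 p l p-prime b a ε L fcf u v _ _ (divides w v≡w*p^l) n relevant =
  (coeff₁ u (+ w) , coeff₂ u (+ w)) , (u-eq , v-eq) , λ α β hu hv → unique α β hu (cancel-p^l α β hv)
  where
  open Cramer {A = conv-p b a ε (suc n)} {conv-p b a ε n} {Q′ 1 a ε (suc (suc n))} {Q′ 1 a ε (suc n)}
              (P′-Q′₁-det b a ε (suc n))
              (detSign-square ε (suc n) λ i 1≤i i≤n+1 →
                IsFCF.ε-sign fcf i 1≤i (Relevant-≤ L i≤n+1 relevant))
  instance
    p^l≢0 : ℕ.NonZero (p ^ l)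
    p^l≢0 = ℕ.m^n≢0 p l {{prime⇒nonZero p-prime}}
  v≡p^l*w : + v ≡ + (p ^ l) * + w
  v≡p^l*w = trans (cong +_ (trans v≡w*p^l (ℕ.*-comm w (p ^ l)))) (ℤ.pos-* (p ^ l) w)
  u-eq : u ≡ coeff₁ u (+ w) * conv-p b a ε (suc n) + coeff₂ u (+ w) * conv-p b a ε n
  u-eq = proj₁ (solves u (+ w))
  v-eq : + v ≡ coeff₁ u (+ w) * conv-q p l a ε (suc n) + coeff₂ u (+ w) * conv-q p l a ε n
  v-eq = trans v≡p^l*w (trans (cong (+ (p ^ l) *_) (proj₂ (solves u (+ w))))
                              (sym (conv-q-combination p l a ε n (coeff₁ u (+ w)) (coeff₂ u (+ w)))))
  cancel-p^l : ∀ α β → + v ≡ α * conv-q p l a ε (suc n) + β * conv-q p l a ε n →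
               + w ≡ α * Q′ 1 a ε (suc (suc n)) + β * Q′ 1 a ε (suc n)
  cancel-p^l α β hv = ℤ.*-cancelˡ-≡ (+ (p ^ l)) (+ w) (α * Q′ 1 a ε (suc (suc n)) + β * Q′ 1 a ε (suc n))
    (trans (sym v≡p^l*w) (trans hv (conv-q-combination p l a ε n α β)))
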